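{- For any modal formula $A$, $\mathsf{KDR}\vdash A$ if and only if $\mathsf{KR}^+\vdash A$.
   Context: $\mathsf{KDR}$ is the least normal modal logic containing $\neg\Box\bot$ and $\Box\neg p\to\Box\neg\Box p$ (i.e. $\mathsf{K}$ plus these axioms, closed under modus ponens, necessitation and substitution). $\mathsf{KR}=\mathsf{K}+\Box\neg p\to\Box\neg\Box p$ (least normal modal logic containing that axiom), and $\mathsf{KR}^+$ is the logic obtained by adding the inference rule "from $\Box A$ infer $A$" to $\mathsf{KR}$. -}

module Defs where

open import Data.Nat using (ℕ)

data Fm : Set where
  var : ℕ → Fm
  ⊥'  : Fm
  _⇒_ : Fm → Fm → Fm
  □_  : Fm → Fm

infixr 5 _⇒_
infix 7 □_

¬'_ : Fm → Fm
¬' A = A ⇒ ⊥'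

infix 6 ¬'_

Subst : Set
Subst = ℕ → Fm

sub : Subst → Fm → Fm
sub σ (var n) = σ n
sub σ ⊥' = ⊥'
sub σ (A ⇒ B) = sub σ A ⇒ sub σ B
sub σ (□ A) = □ sub σ A

p q r : Fm
p = var 0
q = var 1
r = var 2

-- Axioms of K (as single formulas; closure under substitution is a rule).
data AxK : Fm → Set where
  ax1 : AxK (p ⇒ q ⇒ p)
  ax2 : AxK ((p ⇒ q ⇒ r) ⇒ (p ⇒ q) ⇒ p ⇒ r)
  ax3 : AxK (((p ⇒ ⊥') ⇒ ⊥') ⇒ p)
  axK : AxK (□ (p ⇒ q) ⇒ □ p ⇒ □ q)

axR : Fm
axR = □ (¬' p) ⇒ □ (¬' □ p)

axD : Fm
axD = ¬' □ ⊥'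

data KDR⊢_ : Fm → Set where
  axk   : ∀ {A} → AxK A → KDR⊢ A
  axd   : KDR⊢ axD
  axr   : KDR⊢ axR
  mp    : ∀ {A B} → KDR⊢ (A ⇒ B) → KDR⊢ A → KDR⊢ B
  nec   : ∀ {A} → KDR⊢ A → KDR⊢ (□ A)
  usub  : ∀ {A} (σ : Subst) → KDR⊢ A → KDR⊢ (sub σ A)

data KR⁺⊢_ : Fm → Set where
  axk   : ∀ {A} → AxK A → KR⁺⊢ A
  axr   : KR⁺⊢ axR
  mp    : ∀ {A B} → KR⁺⊢ (A ⇒ B) → KR⁺⊢ A → KR⁺⊢ B
  nec   : ∀ {A} → KR⁺⊢ A → KR⁺⊢ (□ A)
  usub  : ∀ {A} (σ : Subst) → KR⁺⊢ A → KR⁺⊢ (sub σ A)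
  unbox : ∀ {A} → KR⁺⊢ (□ A) → KR⁺⊢ A

infix 3 KDR⊢_ KR⁺⊢_

-- KDR ⊆ KR⁺: the only axiom of KDR missing from KR⁺ is D' = ¬□⊥, and it is
-- obtained in KR⁺ by instantiating R at p := ⊥ (giving □¬⊥ → □¬□⊥), applying
-- it to the necessitation of ⊥ → ⊥, and removing the outer box with □A / A.
--
-- KR⁺ ⊆ KDR: it suffices that KDR is closed under the rule □A / A. For this we
-- interpret formulas as types relative to an answer type R, reading □A as the
-- continuation type (KDR⊢ A → R) → R ("a KDR-proof of A can be used to answer").
-- Every KDR theorem, under every substitution, is realized; axiom R is realized
-- because KDR turns a proof of ¬C into a proof of ¬□C (using D'), and D' is
-- realized because KDR is consistent, which we check on the one-point
-- reflexive frame. Taking R := KDR⊢ A, a realizer of □A applied to the identity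
-- continuation yields a KDR-proof of A.
module Submission where

open import Defs
open import Data.Product using (_×_; _,_)
open import Data.Nat using (ℕ)
open import Data.Bool using (Bool; true; false)
open import Data.Empty using (⊥-elim)
open import Relation.Nullary using (¬_)
open import Relation.Binary.PropositionalEquality
  using (_≡_; refl; sym; trans; cong; cong₂; subst)

sub-sub : ∀ σ τ A → sub σ (sub τ A) ≡ sub (λ n → sub σ (τ n)) A
sub-sub σ τ (var n) = refl
sub-sub σ τ ⊥' = refl
sub-sub σ τ (A ⇒ B) = cong₂ _⇒_ (sub-sub σ τ A) (sub-sub σ τ B)
sub-sub σ τ (□ A) = cong □_ (sub-sub σ τ A)

sub-var : ∀ A → sub var A ≡ A
sub-var (var n) = refl
sub-var ⊥' = refl
sub-var (A ⇒ B) = cong₂ _⇒_ (sub-var A) (sub-var B)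
sub-var (□ A) = cong □_ (sub-var A)

⟨pqr↦_∣_∣_⟩ : Fm → Fm → Fm → Subst
⟨pqr↦ A ∣ B ∣ C ⟩ 0 = A
⟨pqr↦ A ∣ B ∣ C ⟩ 1 = B
⟨pqr↦ A ∣ B ∣ C ⟩ _ = C

module NormalLogic
  (L : Fm → Set)
  (axiomK : ∀ {A} → AxK A → L A)
  (modusPonens : ∀ {A B} → L (A ⇒ B) → L A → L B)
  (necessitation : ∀ {A} → L A → L (□ A))
  (substitution : ∀ {A} (σ : Subst) → L A → L (sub σ A))
  where

  weaken : ∀ A B → L (A ⇒ B ⇒ A)
  weaken A B = substitution ⟨pqr↦ A ∣ B ∣ A ⟩ (axiomK ax1)

  distribute : ∀ A B C → L ((A ⇒ B ⇒ C) ⇒ (A ⇒ B) ⇒ A ⇒ C)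
  distribute A B C = substitution ⟨pqr↦ A ∣ B ∣ C ⟩ (axiomK ax2)

  ⇒-refl : ∀ A → L (A ⇒ A)
  ⇒-refl A = modusPonens (modusPonens (distribute A (A ⇒ A) A) (weaken A (A ⇒ A)))
                         (weaken A A)

  ⇒-trans : ∀ {A B C} → L (A ⇒ B) → L (B ⇒ C) → L (A ⇒ C)
  ⇒-trans {A} {B} {C} f g =
    modusPonens (modusPonens (distribute A B C) (modusPonens (weaken (B ⇒ C) A) g)) f

  □-mono : ∀ {A B} → L (A ⇒ B) → L (□ A ⇒ □ B)
  □-mono {A} {B} d = modusPonens (substitution ⟨pqr↦ A ∣ B ∣ B ⟩ (axiomK axK))
                                 (necessitation d)

open NormalLogic KDR⊢_ axk mp nec usub
  using () renaming (⇒-trans to KDR-⇒-trans; □-mono to KDR-□-mono)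
open NormalLogic KR⁺⊢_ axk mp nec usub
  using () renaming (⇒-refl to KR⁺-⇒-refl)

-- Consistency of KDR, via the one-point reflexive frame, where □A holds
-- exactly when A does.

_⊃_ : Bool → Bool → Bool
true ⊃ b = b
false ⊃ _ = true

Valuation : Set
Valuation = ℕ → Bool

truth : Valuation → Fm → Bool
truth v (var n) = v n
truth v ⊥' = false
truth v (A ⇒ B) = truth v A ⊃ truth v B
truth v (□ A) = truth v A

truth-sub : ∀ v σ A → truth v (sub σ A) ≡ truth (λ n → truth v (σ n)) A
truth-sub v σ (var n) = refl
truth-sub v σ ⊥' = refl
truth-sub v σ (A ⇒ B) = cong₂ _⊃_ (truth-sub v σ A) (truth-sub v σ B)
truth-sub v σ (□ A) = truth-sub v σ A

truth-mp : ∀ v A B → truth v (A ⇒ B) ≡ true → truth v A ≡ true → truth v B ≡ true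
truth-mp v A B ⊨A⇒B ⊨A with truth v A
truth-mp v A B ⊨A⇒B refl | true = ⊨A⇒B

truth-AxK : ∀ {A} → AxK A → ∀ v → truth v A ≡ true
truth-AxK ax1 v with v 0 | v 1
... | true  | true  = refl
... | true  | false = refl
... | false | _     = refl
truth-AxK ax2 v with v 0 | v 1 | v 2
... | true  | true  | true  = refl
... | true  | true  | false = refl
... | true  | false | _     = refl
... | false | _     | _     = refl
truth-AxK ax3 v with v 0
... | true  = refl
... | false = refl
truth-AxK axK v with v 0 | v 1
... | true  | true  = refl
... | true  | false = refl
... | false | _     = refl

truth-KDR : ∀ {A} → KDR⊢ A → ∀ v → truth v A ≡ true
truth-KDR (axk ax) v = truth-AxK ax v
truth-KDR axd v = refl
truth-KDR axr v with v 0
... | true  = refl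
... | false = refl
truth-KDR (mp {A} {B} d e) v = truth-mp v A B (truth-KDR d v) (truth-KDR e v)
truth-KDR (nec d) v = truth-KDR d v
truth-KDR (usub {A} σ d) v = trans (truth-sub v σ A) (truth-KDR d _)

KDR-consistent : ¬ (KDR⊢ ⊥')
KDR-consistent d with truth-KDR d (λ _ → true)
... | ()

-- In KDR, a refutable formula has a refutable box: ¬C ⊢ ¬□C, since
-- □C → □⊥ by monotonicity and ¬□⊥ is the axiom D'.
KDR-¬□ : ∀ {C} → KDR⊢ (¬' C) → KDR⊢ (¬' □ C)
KDR-¬□ d = KDR-⇒-trans (KDR-□-mono d) axd

module Realizability (R : Set) where

  ⟦_⟧ : Fm → Set
  ⟦ var n ⟧ = R
  ⟦ ⊥' ⟧ = R
  ⟦ A ⇒ B ⟧ = ⟦ A ⟧ → ⟦ B ⟧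
  ⟦ □ A ⟧ = (KDR⊢ A → R) → R

  -- Every interpretation is stable under double negation relative to R;
  -- this realizes the classical axiom ¬¬p → p.
  ⟦⟧-stable : ∀ A → ((⟦ A ⟧ → R) → R) → ⟦ A ⟧
  ⟦⟧-stable (var n) k = k (λ x → x)
  ⟦⟧-stable ⊥' k = k (λ x → x)
  ⟦⟧-stable (A ⇒ B) k a = ⟦⟧-stable B (λ kb → k (λ f → kb (f a)))
  ⟦⟧-stable (□ A) k kd = k (λ c → c kd)

  realize-AxK : ∀ {A} → AxK A → ∀ σ → ⟦ sub σ A ⟧
  realize-AxK ax1 σ a b = a
  realize-AxK ax2 σ f g a = f a (g a)
  realize-AxK ax3 σ = ⟦⟧-stable (σ 0)
  realize-AxK axK σ f c k = f (λ dCD → c (λ dC → k (mp dCD dC)))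

  realize : ∀ {A} → KDR⊢ A → ∀ σ → ⟦ sub σ A ⟧
  realize (axk ax) σ = realize-AxK ax σ
  realize axd σ k = k (λ d → ⊥-elim (KDR-consistent d))
  realize axr σ f k = f (λ d → k (KDR-¬□ d))
  realize (mp d e) σ = realize d σ (realize e σ)
  realize (nec d) σ k = k (usub σ d)
  realize (usub {A} τ d) σ =
    subst ⟦_⟧ (sym (sub-sub σ τ A)) (realize d (λ n → sub σ (τ n)))

-- KDR is closed under □A / A: realize □A with answer type KDR⊢ A and feed it
-- the identity continuation.
KDR-unbox : ∀ {A} → KDR⊢ (□ A) → KDR⊢ A
KDR-unbox {A} d = subst (λ B → (KDR⊢ B → KDR⊢ A) → KDR⊢ A) (sub-var A)
                        (Realizability.realize (KDR⊢ A) d var) (λ e → e)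

-- D' in KR⁺: from R[p := ⊥] and □(⊥ → ⊥) get □¬□⊥, then unbox.
KR⁺-D : KR⁺⊢ axD
KR⁺-D = unbox (mp (usub (λ _ → ⊥') axr) (nec (KR⁺-⇒-refl ⊥')))

KDR⊆KR⁺ : ∀ {A} → KDR⊢ A → KR⁺⊢ A
KDR⊆KR⁺ (axk ax) = axk ax
KDR⊆KR⁺ axd = KR⁺-D
KDR⊆KR⁺ axr = axr
KDR⊆KR⁺ (mp d e) = mp (KDR⊆KR⁺ d) (KDR⊆KR⁺ e)
KDR⊆KR⁺ (nec d) = nec (KDR⊆KR⁺ d)
KDR⊆KR⁺ (usub σ d) = usub σ (KDR⊆KR⁺ d)

KR⁺⊆KDR : ∀ {A} → KR⁺⊢ A → KDR⊢ A
KR⁺⊆KDR (axk ax) = axk ax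
KR⁺⊆KDR axr = axr
KR⁺⊆KDR (mp d e) = mp (KR⁺⊆KDR d) (KR⁺⊆KDR e)
KR⁺⊆KDR (nec d) = nec (KR⁺⊆KDR d)
KR⁺⊆KDR (usub σ d) = usub σ (KR⁺⊆KDR d)
KR⁺⊆KDR (unbox d) = KDR-unbox (KR⁺⊆KDR d)

proposition4p4 : (A : Fm) → ((KDR⊢ A → KR⁺⊢ A) × (KR⁺⊢ A → KDR⊢ A))
proposition4p4 _ = KDR⊆KR⁺ , KR⁺⊆KDR
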